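{- Let $\Omega_1,\dots,\Omega_k$ be pairwise disjoint non-empty subsets of $[n]$, let $G_i\le\mathrm{Sym}(\Omega_i)$ for $1\le i\le k$, and let $G=G_1\cdot G_2\cdots G_k$ be their internal direct product (the group of permutations $g_1g_2\cdots g_k$, $g_i\in G_i$, with componentwise multiplication), acting on $\Omega=\Omega_1\cup\cdots\cup\Omega_k$ by $x^{g_1\cdots g_k}=g_i(x)$ for $x\in\Omega_i$. If every $G_i$, acting on $\Omega_i$, has the EKR property, then $G$, acting on $\Omega$, has the EKR property.
   Context: For a group $G$ acting faithfully on a finite set $\Omega$: $\pi,\sigma\in G$ intersect if $\pi\sigma^{ -1}$ fixes some point of $\Omega$; a subset is intersecting if every pair of its elements intersect. $G$ has the EKR property if every intersecting subset of $G$ has size at most the size of the largest point-stabilizer $G_x$, $x\in\Omega$. -}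

module Defs where

open import Data.Nat using (ℕ; zero; suc; _≤_)
open import Data.Fin using (Fin; _≟_)
open import Data.Fin.Subset using (Subset; _∈_; _∉_)
open import Data.Fin.Permutation using (Permutation′; _⟨$⟩ʳ_; _∘ₚ_; flip; id)
import Data.Fin.Permutation as P
open import Data.List using (List; []; _∷_; length; filter; concatMap; map)
open import Data.List.Relation.Unary.Any using (Any)
open import Data.List.Relation.Unary.AllPairs using (AllPairs)
open import Data.List.Membership.Propositional using () renaming (_∈_ to _∈ₗ_)
open import Data.Product using (Σ; _×_; ∃; ∃-syntax)
open import Relation.Binary.PropositionalEquality using (_≡_; _≢_)
open import Relation.Nullary using (¬_)

Perm : ℕ → Set
Perm n = Permutation′ n

_≈ₚ_ : ∀ {n} → Perm n → Perm n → Set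
_≈ₚ_ = P._≈_

_∈G_ : ∀ {n} → Perm n → List (Perm n) → Set
π ∈G G = Any (π ≈ₚ_) G

-- A list without repetitions (up to extensional equality): a finite set of
-- permutations whose cardinality is the length of the list.
Distinct : ∀ {n} → List (Perm n) → Set
Distinct = AllPairs (λ π σ → ¬ (π ≈ₚ σ))

-- Composition in the paper's (right action) convention:  x^(πσ) = (x^π)^σ.
-- `π ∘ₚ σ` applies π first, then σ.
-- G ≤ Sym(Ω) with Ω ⊆ [n]: a finite group of permutations of [n] (without
-- repetitions) fixing every point outside Ω; identity, products, inverses.
record IsPermGroupOn {n} (Ω : Subset n) (G : List (Perm n)) : Set where
  field
    distinct   : Distinct G
    supported  : ∀ {g} → g ∈ₗ G → ∀ x → x ∉ Ω → g ⟨$⟩ʳ x ≡ x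
    hasId      : id ∈G G
    closed-∘   : ∀ {g h} → g ∈ₗ G → h ∈ₗ G → (g ∘ₚ h) ∈G G
    closed-inv : ∀ {g} → g ∈ₗ G → flip g ∈G G

Intersect : ∀ {n} → Subset n → Perm n → Perm n → Set
Intersect Ω π σ = ∃[ x ] (x ∈ Ω × (π ∘ₚ flip σ) ⟨$⟩ʳ x ≡ x)

Intersecting : ∀ {n} → Subset n → List (Perm n) → Set
Intersecting Ω F = ∀ {π σ} → π ∈ₗ F → σ ∈ₗ F → Intersect Ω π σ

stabilizer : ∀ {n} → List (Perm n) → Fin n → List (Perm n)
stabilizer G x = filter (λ g → g ⟨$⟩ʳ x ≟ x) G

-- EKR property of G acting on Ω: every intersecting subset F of G has size at
-- most the size of the largest point stabilizer G_x (x ∈ Ω), i.e. at most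
-- |G_x| for some x ∈ Ω.
EKR : ∀ {n} → Subset n → List (Perm n) → Set
EKR {n} Ω G = ∀ (F : List (Perm n)) → Distinct F → (∀ {π} → π ∈ₗ F → π ∈G G) →
          Intersecting Ω F → ∃[ x ] (x ∈ Ω × length F ≤ length (stabilizer G x))

prodList : ∀ {n} k → (Fin k → List (Perm n)) → List (Perm n)
prodList zero    Gs = id ∷ []
prodList (suc k) Gs =
  concatMap (λ g → map (λ h → g ∘ₚ h) (prodList k (λ i → Gs (Fin.suc i)))) (Gs Fin.zero)
  where import Data.Fin as Fin

bigUnion : ∀ {n} k → (Fin k → Subset n) → Subset n
bigUnion zero    Ωs = Data.Fin.Subset.⊥
bigUnion (suc k) Ωs = Ωs Data.Fin.zero Data.Fin.Subset.∪ bigUnion k (λ i → Ωs (Data.Fin.suc i))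

module Submission where

-- Let G = A · B be the product of two factors supported on disjoint sets Ω₁, Ω₂.
-- Two elements g h and g′ h′ of G intersect on Ω₁ ∪ Ω₂ exactly when g, g′ intersect on Ω₁
-- or h, h′ intersect on Ω₂, so an intersecting family of G is an independent set of the
-- tensor product of the derangement graphs of A and B.  If A has the EKR property and s is
-- its largest point-stabiliser size, every independent set S of its derangement graph
-- satisfies |A| |S| ≤ s |N[S]|: each coset of the stabiliser of x minus N[S], together with S,
-- is intersecting and so has at most s elements, and every element outside N[S] lies in at
-- least s of these cosets.  Zhang's argument for tensor products turns these two ratio bounds
-- into the bound max (s_A |B|, s_B |A|) for independent sets of the product, and this is the
-- largest point stabiliser of G, because |G_x| = |A_x| |B| for x ∈ Ω₁.

open import Defs
open import Data.Empty using (⊥-elim)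
open import Data.Fin using (Fin; zero; suc; _≟_; punchIn; combine; remQuot; _↑ˡ_; _↑ʳ_)
open import Data.Fin.Permutation using (_⟨$⟩ʳ_; _⟨$⟩ˡ_; _∘ₚ_; flip; id; inverseˡ; inverseʳ)
open import Data.Fin.Properties using (any?; all?; punchInᵢ≢i; remQuot-combine; combine-injective)
  renaming (suc-injective to fsuc-injective)
open import Data.Fin.Subset using (Subset; _∈_; _∉_; _∪_; ⊥; Nonempty)
open import Data.Fin.Subset.Properties using (_∈?_; x∈p∪q⁻; p⊆p∪q; q⊆p∪q; ∉⊥)
open import Data.List using (List; []; _∷_; length; filter; map; concatMap; lookup; tabulate; allFin; _++_)
open import Data.List.Membership.Propositional using (find) renaming (_∈_ to _∈ₗ_)
open import Data.List.Membership.Propositional.Properties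
  using (∈-concat⁻′; ∈-concat⁺′; ∈-map⁻; ∈-map⁺; ∈-lookup; ∈-filter⁺; ∈-filter⁻; ∈-allFin)
open import Data.List.Properties
  using (length-map; length-++; filter-++; filter-some; length-filter; tabulate-lookup; map-tabulate)
open import Data.List.Relation.Binary.Disjoint.Setoid using (Disjoint)
open import Data.List.Relation.Unary.All using (All; []; _∷_)
import Data.List.Relation.Unary.All as All
import Data.List.Relation.Unary.All.Properties as All
open import Data.List.Relation.Unary.AllPairs using ([]; _∷_)
open import Data.List.Relation.Unary.Any using (here; there)
import Data.List.Relation.Unary.Any as Any
open import Data.List.Relation.Unary.Any.Properties using (lookup-index)
open import Data.List.Relation.Unary.Unique.Propositional using (Unique)
import Data.List.Relation.Unary.Unique.Propositional.Properties as Unique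
import Data.List.Relation.Unary.Unique.Setoid.Properties as Uniqueₛ
open import Data.Nat hiding (_≟_)
open import Data.Nat.Properties hiding (_≟_)
open import Algebra.Properties.Semiring.Sum +-*-semiring
  using (sum; sum-syntax; ∑-distrib-+; ∑-comm; sum-remove; sum-cong-≗; *-distribˡ-sum)
open import Data.Nat.Tactic.RingSolver using (solve-∀)
open import Data.List.Extrema ≤-totalOrder using (argmax; argmax-all; f[xs]≤f[argmax])
open import Data.Product using (_×_; _,_; ∃-syntax; proj₁; proj₂; uncurry)
open import Data.Product.Properties using (×-≡,≡→≡)
open import Data.Sum using (_⊎_; inj₁; inj₂)
open import Data.Unit using (tt)
open import Function using (_∘_)
open import Level using (0ℓ)
open import Relation.Binary using (Rel; Symmetric; Setoid)
open import Relation.Binary.PropositionalEquality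
  using (_≡_; _≢_; refl; sym; trans; cong; cong₂; subst; subst₂; setoid; module ≡-Reasoning)
open import Relation.Nullary using (Dec; yes; no; ¬_; ¬?; _×-dec_)
open import Relation.Nullary.Decidable using (decidable-stable)
open import Relation.Unary using (Pred; Decidable; _⊆_; _≐_; _∩_; ∁)
open import Relation.Unary.Properties using (_∩?_; _∪?_; ∁?; U?)

-- Finite sums and counting decidable subsets of Fin n

∑-mono-≤ : ∀ {n} {f g : Fin n → ℕ} → (∀ i → f i ≤ g i) → sum f ≤ sum g
∑-mono-≤ {zero}  f≤g = z≤n
∑-mono-≤ {suc n} f≤g = +-mono-≤ (f≤g zero) (∑-mono-≤ (f≤g ∘ suc))

∑-const : ∀ n c → ∑[ i < n ] c ≡ n * c
∑-const zero    c = refl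
∑-const (suc n) c = cong (c +_) (∑-const n c)

∑-* : ∀ {n} c (f : Fin n → ℕ) → ∑[ i < n ] (c * f i) ≡ c * sum f
∑-* c f = sym (*-distribˡ-sum c f)

∑-*+* : ∀ {n} a b (f g : Fin n → ℕ) → ∑[ i < n ] (a * f i + b * g i) ≡ a * sum f + b * sum g
∑-*+* a b f g = trans (∑-distrib-+ (λ i → a * f i) (λ i → b * g i)) (cong₂ _+_ (∑-* a f) (∑-* b g))

∑-++ : ∀ m {n} (f : Fin (m + n) → ℕ) → sum f ≡ ∑[ i < m ] f (i ↑ˡ n) + ∑[ j < n ] f (m ↑ʳ j)
∑-++ zero    f = refl
∑-++ (suc m) f = trans (cong (f zero +_) (∑-++ m (f ∘ suc))) (sym (+-assoc (f zero) _ _))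

∑-combine : ∀ m n (f : Fin (m * n) → ℕ) → sum f ≡ ∑[ i < m ] ∑[ j < n ] f (combine i j)
∑-combine zero    n f = refl
∑-combine (suc m) n f = trans (∑-++ n {m * n} f)
  (cong (∑[ j < n ] f (combine {suc m} zero j) +_) (∑-combine m n (λ k → f (n ↑ʳ k))))

ind : ∀ {A : Set} → Dec A → ℕ
ind (yes _) = 1
ind (no _)  = 0

ind-mono : ∀ {A B : Set} → (A → B) → (a? : Dec A) (b? : Dec B) → ind a? ≤ ind b?
ind-mono A⇒B (yes a) (yes b) = ≤-refl
ind-mono A⇒B (yes a) (no ¬b) = ⊥-elim (¬b (A⇒B a))
ind-mono A⇒B (no ¬a) b?      = z≤n

ind-≤-1 : ∀ {A : Set} (a? : Dec A) → ind a? ≤ 1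
ind-≤-1 (yes _) = ≤-refl
ind-≤-1 (no _)  = z≤n

ind-split : ∀ {A B : Set} (a? : Dec A) (b? : Dec B) → ind a? ≡ ind (a? ×-dec b?) + ind (a? ×-dec ¬? b?)
ind-split (yes a) (yes b) = refl
ind-split (yes a) (no ¬b) = refl
ind-split (no ¬a) b?      = refl

ind-complement : ∀ {A : Set} (a? : Dec A) → ind a? + ind (¬? a?) ≡ 1
ind-complement (yes _) = refl
ind-complement (no _)  = refl

ind-disjoint : ∀ {A B C : Set} (a? : Dec A) (b? : Dec B) (c? : Dec C) →
               (A → C) → (B → C) → (A → ¬ B) → ind a? + ind b? ≤ ind c?
ind-disjoint (yes a) (yes b) c? A⇒C B⇒C A#B = ⊥-elim (A#B a b)
ind-disjoint (yes a) (no _)  c? A⇒C B⇒C A#B = ind-mono A⇒C (yes a) c?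
ind-disjoint (no _)  b?      c? A⇒C B⇒C A#B = ind-mono B⇒C b? c?

count : ∀ {n} {P : Pred (Fin n) 0ℓ} → Decidable P → ℕ
count {n} P? = ∑[ i < n ] ind (P? i)

module _ {n : ℕ} where

  count-mono : ∀ {P Q : Pred (Fin n) 0ℓ} (P? : Decidable P) (Q? : Decidable Q) → P ⊆ Q → count P? ≤ count Q?
  count-mono P? Q? P⊆Q = ∑-mono-≤ (λ i → ind-mono P⊆Q (P? i) (Q? i))

  count-cong : ∀ {P Q : Pred (Fin n) 0ℓ} (P? : Decidable P) (Q? : Decidable Q) → P ≐ Q → count P? ≡ count Q?
  count-cong P? Q? (P⊆Q , Q⊆P) = ≤-antisym (count-mono P? Q? P⊆Q) (count-mono Q? P? Q⊆P)

  count-≤ : ∀ {P : Pred (Fin n) 0ℓ} (P? : Decidable P) → count P? ≤ n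
  count-≤ P? = subst (count P? ≤_) (trans (∑-const n 1) (*-identityʳ n)) (∑-mono-≤ (ind-≤-1 ∘ P?))

  count-complement : ∀ {P : Pred (Fin n) 0ℓ} (P? : Decidable P) → count P? + count (∁? P?) ≡ n
  count-complement P? = begin
    count P? + count (∁? P?)                   ≡⟨ ∑-distrib-+ (ind ∘ P?) (ind ∘ ∁? P?) ⟨
    ∑[ i < n ] (ind (P? i) + ind (¬? (P? i))) ≡⟨ sum-cong-≗ (ind-complement ∘ P?) ⟩
    ∑[ i < n ] 1                               ≡⟨ trans (∑-const n 1) (*-identityʳ n) ⟩
    n                                          ∎
    where open ≡-Reasoning

  count-split : ∀ {P Q : Pred (Fin n) 0ℓ} (P? : Decidable P) (Q? : Decidable Q) →
                count P? ≡ count (P? ∩? Q?) + count (P? ∩? ∁? Q?)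
  count-split P? Q? = trans (sum-cong-≗ (λ i → ind-split (P? i) (Q? i)))
    (∑-distrib-+ (ind ∘ (P? ∩? Q?)) (ind ∘ (P? ∩? ∁? Q?)))

  count-≤-+∖ : ∀ {P Q : Pred (Fin n) 0ℓ} (P? : Decidable P) (Q? : Decidable Q) →
               count Q? ≤ count P? + count (Q? ∩? ∁? P?)
  count-≤-+∖ P? Q? = subst (_≤ count P? + count (Q? ∩? ∁? P?)) (sym (count-split Q? P?))
    (+-monoˡ-≤ (count (Q? ∩? ∁? P?)) (count-mono (Q? ∩? P?) P? proj₂))

  count-disjoint : ∀ {P Q R : Pred (Fin n) 0ℓ} (P? : Decidable P) (Q? : Decidable Q) (R? : Decidable R) →
                   P ⊆ R → Q ⊆ R → (∀ i → P i → ¬ Q i) → count P? + count Q? ≤ count R?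
  count-disjoint P? Q? R? P⊆R Q⊆R P#Q = subst (_≤ count R?) (∑-distrib-+ (ind ∘ P?) (ind ∘ Q?))
    (∑-mono-≤ (λ i → ind-disjoint (P? i) (Q? i) (R? i) P⊆R Q⊆R (P#Q i)))

count-remove : ∀ {n} {P : Pred (Fin n) 0ℓ} (P? : Decidable P) {x} → P x →
               count P? ≡ suc (count (P? ∩? λ i → ¬? (i ≟ x)))
count-remove {suc n} {P} P? {x} Px = begin
  ∑[ i < suc n ] ind (P? i)                            ≡⟨ sum-remove (ind ∘ P?) ⟩
  ind (P? x) + ∑[ j < n ] ind (P? (punchIn x j))       ≡⟨ cong₂ _+_ removed (sum-cong-≗ kept) ⟩
  suc (ind (Q? x) + ∑[ j < n ] ind (Q? (punchIn x j))) ≡⟨ cong suc (sum-remove (ind ∘ Q?)) ⟨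
  suc (count Q?)                                       ∎
  where
  open ≡-Reasoning
  Q? : Decidable (λ i → P i × i ≢ x)
  Q? = P? ∩? λ i → ¬? (i ≟ x)
  removed : ind (P? x) ≡ suc (ind (P? x ×-dec ¬? (x ≟ x)))
  removed with P? x | x ≟ x
  ... | yes _  | yes _  = refl
  ... | no ¬Px | _      = ⊥-elim (¬Px Px)
  ... | _      | no x≢x = ⊥-elim (x≢x refl)
  kept : ∀ j → ind (P? (punchIn x j)) ≡ ind (P? (punchIn x j) ×-dec ¬? (punchIn x j ≟ x))
  kept j with P? (punchIn x j) | punchIn x j ≟ x
  ... | _     | yes eq = ⊥-elim (punchInᵢ≢i x j eq)
  ... | yes _ | no _   = refl
  ... | no _  | no _   = refl

pigeonhole : ∀ {n} {P : Pred (Fin n) 0ℓ} (P? : Decidable P) {xs} → Unique xs → All P xs → length xs ≤ count P?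
pigeonhole P? []           []         = z≤n
pigeonhole P? (x∉xs ∷ xs!) (Px ∷ Pxs) = subst (_ ≤_) (sym (count-remove P? Px))
  (s≤s (pigeonhole _ xs! (All.zipWith (λ (Py , x≢y) → Py , x≢y ∘ sym) (Pxs , x∉xs))))

count₂ : ∀ {m n} {I : Fin m → Fin n → Set} → (∀ i j → Dec (I i j)) → ℕ
count₂ {m} I? = ∑[ i < m ] count (I? i)

count₂-transpose : ∀ {m n} {I : Fin m → Fin n → Set} (I? : ∀ i j → Dec (I i j)) →
                   count₂ I? ≡ count₂ (λ j i → I? i j)
count₂-transpose I? = ∑-comm (λ i j → ind (I? i j))

pigeonhole₂ : ∀ {m n} {I : Fin m → Fin n → Set} (I? : ∀ i j → Dec (I i j)) {xs : List (Fin m × Fin n)} →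
              Unique xs → All (uncurry I) xs → length xs ≤ count₂ I?
pigeonhole₂ {m} {n} {I} I? {xs} xs! Ixs = begin
  length xs                                    ≡⟨ length-map (uncurry combine) xs ⟨
  length (map (uncurry combine) xs)
    ≤⟨ pigeonhole J? (Unique.map⁺ combine-inj xs!) (All.map⁺ (All.map J-combine Ixs)) ⟩
  count J?                                     ≡⟨ ∑-combine m n (ind ∘ J?) ⟩
  ∑[ i < m ] ∑[ j < n ] ind (J? (combine i j))
    ≡⟨ sum-cong-≗ (λ i → sum-cong-≗ (λ j → cong (ind ∘ uncurry I?) (remQuot-combine i j))) ⟩
  count₂ I?                                    ∎
  where
  open ≤-Reasoning
  J? : Decidable (uncurry I ∘ remQuot n)
  J? = uncurry I? ∘ remQuot n
  combine-inj : ∀ {x y : Fin m × Fin n} → uncurry combine x ≡ uncurry combine y → x ≡ y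
  combine-inj {i , j} {k , l} eq = ×-≡,≡→≡ (combine-injective i j k l eq)
  J-combine : ∀ {x} → uncurry I x → uncurry I (remQuot n (uncurry combine x))
  J-combine {i , j} = subst (uncurry I) (sym (remQuot-combine i j))

length-filter-tabulate : ∀ {A : Set} {n} {P : Pred A 0ℓ} (P? : Decidable P) (f : Fin n → A) →
                         length (filter P? (tabulate f)) ≡ count (P? ∘ f)
length-filter-tabulate {n = zero}  P? f = refl
length-filter-tabulate {n = suc n} P? f with P? (f zero)
... | yes _ = cong suc (length-filter-tabulate P? (f ∘ suc))
... | no _  = length-filter-tabulate P? (f ∘ suc)

length-filter≡count : ∀ {A : Set} {P : Pred A 0ℓ} (P? : Decidable P) (xs : List A) →
                      length (filter P? xs) ≡ count (P? ∘ lookup xs)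
length-filter≡count P? xs =
  trans (cong (length ∘ filter P?) (sym (tabulate-lookup xs))) (length-filter-tabulate P? (lookup xs))

-- Independent sets of tensor products of graphs

m*x+n*y≤m*n⇒x+y≤m⊔n : ∀ {m n x y} → m * x + n * y ≤ m * n → 0 < m → 0 < n → x + y ≤ m ⊔ n
m*x+n*y≤m*n⇒x+y≤m⊔n {m} {n} {x} {y} bound 0<m 0<n with ≤-total m n
... | inj₁ m≤n = subst (x + y ≤_) (sym (m≤n⇒m⊔n≡n m≤n)) (*-cancelˡ-≤ m {{>-nonZero 0<m}} (begin
  m * (x + y)   ≡⟨ *-distribˡ-+ m x y ⟩
  m * x + m * y ≤⟨ +-monoʳ-≤ (m * x) (*-monoˡ-≤ y m≤n) ⟩
  m * x + n * y ≤⟨ bound ⟩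
  m * n         ∎))
  where open ≤-Reasoning
... | inj₂ n≤m = subst (x + y ≤_) (sym (m≥n⇒m⊔n≡m n≤m)) (*-cancelˡ-≤ n {{>-nonZero 0<n}} (begin
  n * (x + y)   ≡⟨ *-distribˡ-+ n x y ⟩
  n * x + n * y ≤⟨ +-monoˡ-≤ (n * y) (*-monoˡ-≤ x n≤m) ⟩
  m * x + n * y ≤⟨ bound ⟩
  m * n         ≡⟨ *-comm m n ⟩
  n * m         ∎))
  where open ≤-Reasoning

row-column-bounds⇒ : ∀ {p q sA sB x y u v} →
  q * x ≤ sB * x + sB * u → p * y + sA * x ≤ sA * v → u + v ≤ p * q →
  sA * q * x + sB * p * y ≤ sA * q * (sB * p)
row-column-bounds⇒ {p} {q} {sA} {sB} {x} {y} {u} {v} rows columns boundary =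
  +-cancelˡ-≤ (sA * sB * x) _ _ (begin
    sA * sB * x + (sA * q * x + sB * p * y) ≡⟨ regroup₁ p q sA sB x y ⟩
    sA * (q * x) + sB * (p * y + sA * x)    ≤⟨ +-mono-≤ (*-monoʳ-≤ sA rows) (*-monoʳ-≤ sB columns) ⟩
    sA * (sB * x + sB * u) + sB * (sA * v)  ≡⟨ regroup₂ sA sB x u v ⟩
    sA * sB * x + sA * sB * (u + v)         ≤⟨ +-monoʳ-≤ (sA * sB * x) (*-monoʳ-≤ (sA * sB) boundary) ⟩
    sA * sB * x + sA * sB * (p * q)         ≡⟨ regroup₃ p q sA sB x ⟩
    sA * sB * x + sA * q * (sB * p)         ∎)
  where
  open ≤-Reasoning
  regroup₁ : ∀ p q sA sB x y → sA * sB * x + (sA * q * x + sB * p * y) ≡ sA * (q * x) + sB * (p * y + sA * x)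
  regroup₁ = solve-∀
  regroup₂ : ∀ sA sB x u v → sA * (sB * x + sB * u) + sB * (sA * v) ≡ sA * sB * x + sA * sB * (u + v)
  regroup₂ = solve-∀
  regroup₃ : ∀ p q sA sB x → sA * sB * x + sA * sB * (p * q) ≡ sA * sB * x + sA * q * (sB * p)
  regroup₃ = solve-∀

module _ {n : ℕ} where

  Independent : Rel (Fin n) 0ℓ → Pred (Fin n) 0ℓ → Set
  Independent R S = ∀ {i j} → S i → S j → ¬ R i j

  AdjacentTo : Rel (Fin n) 0ℓ → Pred (Fin n) 0ℓ → Pred (Fin n) 0ℓ
  AdjacentTo R S i = ∃[ j ] (S j × R i j)

  ClosedNbhd : Rel (Fin n) 0ℓ → Pred (Fin n) 0ℓ → Pred (Fin n) 0ℓ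
  ClosedNbhd R S i = S i ⊎ AdjacentTo R S i

  module _ {R : Rel (Fin n) 0ℓ} (R? : ∀ i j → Dec (R i j)) where

    adjacentTo? : ∀ {S} → Decidable S → Decidable (AdjacentTo R S)
    adjacentTo? S? i = any? (λ j → S? j ×-dec R? i j)

    closedNbhd? : ∀ {S} → Decidable S → Decidable (ClosedNbhd R S)
    closedNbhd? S? = S? ∪? adjacentTo? S?

    -- For vertex-transitive graphs this holds with s the independence number; it is all that
    -- Zhang's argument below uses about the two factors.
    NeighbourhoodBound : ℕ → Set₁
    NeighbourhoodBound s = ∀ {S} (S? : Decidable S) → Independent R S → n * count S? ≤ s * count (closedNbhd? S?)

TensorIndependent : ∀ {p q} → Rel (Fin p) 0ℓ → Rel (Fin q) 0ℓ → (Fin p → Fin q → Set) → Set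
TensorIndependent RA RB I = ∀ {i j i′ j′} → I i j → I i′ j′ → RA i i′ → ¬ RB j j′

module _ {p q : ℕ} {RA : Rel (Fin p) 0ℓ} {RB : Rel (Fin q) 0ℓ}
  (RA? : ∀ i i′ → Dec (RA i i′)) (RB? : ∀ j j′ → Dec (RB j j′))
  (RA-sym : Symmetric RA) (RB-sym : Symmetric RB)
  {sA sB : ℕ} (boundA : NeighbourhoodBound RA? sA) (boundB : NeighbourhoodBound RB? sB)
  {I : Fin p → Fin q → Set} (I? : ∀ i j → Dec (I i j)) (I-indep : TensorIndependent RA RB I)
  where

  private
    column : Fin q → Pred (Fin p) 0ℓ
    column j i = I i j

    column? : ∀ j → Decidable (column j)
    column? j i = I? i j

    Linked : Fin p → Fin q → Set
    Linked i j = AdjacentTo RA (column j) i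

    linked? : ∀ i j → Dec (Linked i j)
    linked? i j = adjacentTo? RA? (column? j) i

    -- I splits into I⁺, the pairs with an RA-neighbour in their own column of I, and I⁻.
    -- The rows of I⁺ are RB-independent and the columns of I⁻ are RA-independent.
    I⁺ I⁻ : Fin p → Fin q → Set
    I⁺ i j = I i j × Linked i j
    I⁻ i j = I i j × ¬ Linked i j

    I⁺? : ∀ i j → Dec (I⁺ i j)
    I⁺? i j = I? i j ×-dec linked? i j

    I⁻? : ∀ i j → Dec (I⁻ i j)
    I⁻? i j = I? i j ×-dec ¬? (linked? i j)

    rowRest? : ∀ i → Decidable (ClosedNbhd RB (I⁺ i) ∩ ∁ (I⁺ i))
    rowRest? i = closedNbhd? RB? (I⁺? i) ∩? ∁? (I⁺? i)

    columnNbhd? : ∀ j → Decidable (ClosedNbhd RA (column j))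
    columnNbhd? j = closedNbhd? RA? (column? j)

    row-independent : ∀ i → Independent RB (I⁺ i)
    row-independent i (Iij , _) (_ , i′ , Ii′j′ , RAii′) = I-indep Iij Ii′j′ RAii′

    column-independent : ∀ j → Independent RA (λ i → I⁻ i j)
    column-independent j {i} {i′} (_ , ¬linked) (Ii′j , _) RAii′ = ¬linked (i′ , Ii′j , RAii′)

    row-bound : ∀ i → q * count (I⁺? i) ≤ sB * count (I⁺? i) + sB * count (rowRest? i)
    row-bound i = begin
      q * count (I⁺? i)                            ≤⟨ boundB (I⁺? i) (row-independent i) ⟩
      sB * count (closedNbhd? RB? (I⁺? i))         ≤⟨ *-monoʳ-≤ sB (count-≤-+∖ (I⁺? i) (closedNbhd? RB? (I⁺? i))) ⟩
      sB * (count (I⁺? i) + count (rowRest? i))    ≡⟨ *-distribˡ-+ sB _ _ ⟩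
      sB * count (I⁺? i) + sB * count (rowRest? i) ∎
      where open ≤-Reasoning

    column-bound : ∀ j → p * count (λ i → I⁻? i j) + sA * count (λ i → I⁺? i j) ≤ sA * count (columnNbhd? j)
    column-bound j = begin
      p * count I⁻ʲ? + sA * count I⁺ʲ?
        ≤⟨ +-monoˡ-≤ (sA * count I⁺ʲ?) (boundA I⁻ʲ? (column-independent j)) ⟩
      sA * count (closedNbhd? RA? I⁻ʲ?) + sA * count I⁺ʲ?
        ≡⟨ *-distribˡ-+ sA _ _ ⟨
      sA * (count (closedNbhd? RA? I⁻ʲ?) + count I⁺ʲ?)
        ≤⟨ *-monoʳ-≤ sA (count-disjoint _ I⁺ʲ? (columnNbhd? j) ⊆nbhd₁ ⊆nbhd₂ disjoint) ⟩
      sA * count (columnNbhd? j)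
        ∎
      where
      open ≤-Reasoning
      I⁻ʲ? : Decidable (λ i → I⁻ i j)
      I⁻ʲ? i = I⁻? i j
      I⁺ʲ? : Decidable (λ i → I⁺ i j)
      I⁺ʲ? i = I⁺? i j
      ⊆nbhd₁ : ClosedNbhd RA (λ i → I⁻ i j) ⊆ ClosedNbhd RA (column j)
      ⊆nbhd₁ (inj₁ (Iij , _))           = inj₁ Iij
      ⊆nbhd₁ (inj₂ (c , (Icj , _) , r)) = inj₂ (c , Icj , r)
      ⊆nbhd₂ : (λ i → I⁺ i j) ⊆ ClosedNbhd RA (column j)
      ⊆nbhd₂ (Iij , _) = inj₁ Iij
      disjoint : ∀ i → ClosedNbhd RA (λ i → I⁻ i j) i → ¬ I⁺ i j
      disjoint i (inj₁ (_ , ¬linked))           (_ , linked) = ¬linked linked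
      disjoint i (inj₂ (c , (_ , ¬linked) , r)) (Iij , _)    = ¬linked (i , Iij , RA-sym r)

    boundary-bound : ∀ i → count (rowRest? i) + count (λ j → columnNbhd? j i) ≤ q
    boundary-bound i =
      ≤-trans (count-disjoint (rowRest? i) (λ j → columnNbhd? j i) U? (λ _ → tt) (λ _ → tt) disjoint) (count-≤ U?)
      where
      disjoint : ∀ j → (ClosedNbhd RB (I⁺ i) ∩ ∁ (I⁺ i)) j → ¬ ClosedNbhd RA (column j) i
      disjoint j (inj₁ I⁺ij , ¬I⁺ij) _ = ¬I⁺ij I⁺ij
      disjoint j (inj₂ (j′ , (_ , i″ , Ii″j′ , RAii″) , RBjj′) , _) (inj₁ Iij) =
        I-indep Iij Ii″j′ RAii″ RBjj′
      disjoint j (inj₂ (j′ , (Iij′ , _) , RBjj′) , _) (inj₂ (i′ , Ii′j , RAii′)) =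
        I-indep Iij′ Ii′j RAii′ (RB-sym RBjj′)

  tensor-independent-bound : 0 < sA * q → 0 < sB * p → count₂ I? ≤ sA * q ⊔ sB * p
  tensor-independent-bound 0<sAq 0<sBp = begin
    count₂ I?
      ≡⟨ trans (sum-cong-≗ (λ i → count-split (I? i) (linked? i))) (∑-distrib-+ (count ∘ I⁺?) (count ∘ I⁻?)) ⟩
    count₂ I⁺? + count₂ I⁻?
      ≤⟨ m*x+n*y≤m*n⇒x+y≤m⊔n (row-column-bounds⇒ {p} {q} {sA} {sB} rows columns boundary) 0<sAq 0<sBp ⟩
    sA * q ⊔ sB * p
      ∎
    where
    open ≤-Reasoning
    rows : q * count₂ I⁺? ≤ sB * count₂ I⁺? + sB * count₂ rowRest?
    rows = subst₂ _≤_ (∑-* q (count ∘ I⁺?)) (∑-*+* sB sB (count ∘ I⁺?) (count ∘ rowRest?)) (∑-mono-≤ row-bound)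
    columns : p * count₂ I⁻? + sA * count₂ I⁺? ≤ sA * count₂ columnNbhd?
    columns = subst₂ _≤_
      (trans (∑-*+* p sA (λ j → count (λ i → I⁻? i j)) (λ j → count (λ i → I⁺? i j)))
             (sym (cong₂ (λ x y → p * x + sA * y) (count₂-transpose I⁻?) (count₂-transpose I⁺?))))
      (∑-* sA (count ∘ columnNbhd?))
      (∑-mono-≤ column-bound)
    boundary : count₂ rowRest? + count₂ columnNbhd? ≤ p * q
    boundary = subst₂ _≤_
      (trans (∑-distrib-+ (count ∘ rowRest?) (λ i → count (λ j → columnNbhd? j i)))
             (cong (count₂ rowRest? +_) (sym (count₂-transpose columnNbhd?))))
      (∑-const p q)
      (∑-mono-≤ boundary-bound)

-- Permutations, their supports and families of them

module _ {n : ℕ} where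

  ≈ₚ-setoid : Setoid _ _
  ≈ₚ-setoid = record
    { Carrier       = Perm n
    ; _≈_           = _≈ₚ_
    ; isEquivalence = record
      { refl  = λ _ → refl
      ; sym   = λ π≈σ x → sym (π≈σ x)
      ; trans = λ π≈σ σ≈τ x → trans (π≈σ x) (σ≈τ x)
      }
    }

  ≈ₚ-dec : (π σ : Perm n) → Dec (π ≈ₚ σ)
  ≈ₚ-dec π σ = all? (λ x → π ⟨$⟩ʳ x ≟ σ ⟨$⟩ʳ x)

  ∘ₚ-cong : ∀ {π π′ σ σ′ : Perm n} → π ≈ₚ π′ → σ ≈ₚ σ′ → (π ∘ₚ σ) ≈ₚ (π′ ∘ₚ σ′)
  ∘ₚ-cong {π′ = π′} {σ = σ} π≈π′ σ≈σ′ x = trans (cong (σ ⟨$⟩ʳ_) (π≈π′ x)) (σ≈σ′ (π′ ⟨$⟩ʳ x))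

  ⟨$⟩ʳ-injective : (π : Perm n) {x y : Fin n} → π ⟨$⟩ʳ x ≡ π ⟨$⟩ʳ y → x ≡ y
  ⟨$⟩ʳ-injective π eq = trans (sym (inverseˡ π)) (trans (cong (π ⟨$⟩ˡ_) eq) (inverseˡ π))

  ∘ₚ-cancelʳ : (π σ τ : Perm n) → (π ∘ₚ τ) ≈ₚ (σ ∘ₚ τ) → π ≈ₚ σ
  ∘ₚ-cancelʳ π σ τ eq x = ⟨$⟩ʳ-injective τ (eq x)

  ∘ₚ-cancelˡ : (π σ τ : Perm n) → (π ∘ₚ σ) ≈ₚ (π ∘ₚ τ) → σ ≈ₚ τ
  ∘ₚ-cancelˡ π σ τ eq x = trans (cong (σ ⟨$⟩ʳ_) (sym (inverseʳ π)))
                                (trans (eq (π ⟨$⟩ˡ x)) (cong (τ ⟨$⟩ʳ_) (inverseʳ π)))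

  ∈G-resp-≈ : ∀ {π σ : Perm n} {L} → π ≈ₚ σ → σ ∈G L → π ∈G L
  ∈G-resp-≈ π≈σ = Any.map λ σ≈τ x → trans (π≈σ x) (σ≈τ x)

  intersect⇒agree : ∀ {Ω : Subset n} {π σ : Perm n} → Intersect Ω π σ → ∃[ x ] (x ∈ Ω × π ⟨$⟩ʳ x ≡ σ ⟨$⟩ʳ x)
  intersect⇒agree {σ = σ} (x , x∈Ω , fixed) = x , x∈Ω , trans (sym (inverseʳ σ)) (cong (σ ⟨$⟩ʳ_) fixed)

  agree⇒intersect : ∀ {Ω : Subset n} {π σ : Perm n} {x} → x ∈ Ω → π ⟨$⟩ʳ x ≡ σ ⟨$⟩ʳ x → Intersect Ω π σ
  agree⇒intersect {σ = σ} {x} x∈Ω agree = x , x∈Ω , trans (cong (σ ⟨$⟩ˡ_) agree) (inverseˡ σ)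

  intersect-sym : ∀ {Ω : Subset n} {π σ : Perm n} → Intersect Ω π σ → Intersect Ω σ π
  intersect-sym {π = π} {σ} π∩σ with x , x∈Ω , agree ← intersect⇒agree {π = π} {σ} π∩σ =
    agree⇒intersect {π = σ} {π} x∈Ω (sym agree)

  intersect-resp-≈ : ∀ {Ω : Subset n} {π π′ σ σ′ : Perm n} → π ≈ₚ π′ → σ ≈ₚ σ′ → Intersect Ω π σ → Intersect Ω π′ σ′
  intersect-resp-≈ {π = π} {π′} {σ} {σ′} π≈π′ σ≈σ′ π∩σ with x , x∈Ω , agree ← intersect⇒agree {π = π} {σ} π∩σ =
    agree⇒intersect {π = π′} {σ′} x∈Ω (trans (sym (π≈π′ x)) (trans agree (σ≈σ′ x)))

  intersect? : ∀ Ω (π σ : Perm n) → Dec (Intersect Ω π σ)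
  intersect? Ω π σ = any? (λ x → (x ∈? Ω) ×-dec ((π ∘ₚ flip σ) ⟨$⟩ʳ x ≟ x))

  record Supported (Ω : Subset n) (g : Perm n) : Set where
    constructor mkSupported
    field fixes : ∀ x → x ∉ Ω → g ⟨$⟩ʳ x ≡ x

  open Supported public

  supported-∈ : ∀ {Ω : Subset n} {g} → Supported Ω g → ∀ {x} → x ∈ Ω → g ⟨$⟩ʳ x ∈ Ω
  supported-∈ {Ω} {g} g-supp {x} x∈Ω with g ⟨$⟩ʳ x ∈? Ω
  ... | yes gx∈Ω = gx∈Ω
  ... | no gx∉Ω  = ⊥-elim (gx∉Ω (subst (_∈ Ω) (sym (⟨$⟩ʳ-injective g (fixes g-supp _ gx∉Ω))) x∈Ω))

  supported-flip : ∀ {Ω : Subset n} {g} → Supported Ω g → Supported Ω (flip g)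
  supported-flip {g = g} g-supp = mkSupported λ x x∉Ω → trans (cong (g ⟨$⟩ˡ_) (sym (fixes g-supp x x∉Ω))) (inverseˡ g)

  maximiser : ∀ {Ω : Subset n} → Nonempty Ω → (f : Fin n → ℕ) → ∃[ x ] (x ∈ Ω × ∀ {y} → y ∈ Ω → f y ≤ f x)
  maximiser {Ω} (x₀ , x₀∈Ω) f = argmax f x₀ points , argmax-all f x₀∈Ω (All.all-filter (_∈? Ω) (allFin n)) ,
    λ y∈Ω → All.lookup (f[xs]≤f[argmax] x₀ points) (∈-filter⁺ (_∈? Ω) (∈-allFin _) y∈Ω)
    where
    points : List (Fin n)
    points = filter (_∈? Ω) (allFin n)

  Distinct⇒lookup-injective : ∀ {L : List (Perm n)} → Distinct L → ∀ {i j} → lookup L i ≈ₚ lookup L j → i ≡ j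
  Distinct⇒lookup-injective {_ ∷ L} (_   ∷ _)  {zero}  {zero}  _  = refl
  Distinct⇒lookup-injective {_ ∷ L} (π∉L ∷ _)  {zero}  {suc j} π≈ = ⊥-elim (All.lookup π∉L (∈-lookup {xs = L} j) π≈)
  Distinct⇒lookup-injective {_ ∷ L} (π∉L ∷ _)  {suc i} {zero}  ≈π = ⊥-elim (All.lookup π∉L (∈-lookup {xs = L} i) (λ x → sym (≈π x)))
  Distinct⇒lookup-injective {_ ∷ L} (_   ∷ L!) {suc i} {suc j} eq = cong suc (Distinct⇒lookup-injective L! eq)

  index : ∀ {π} {L : List (Perm n)} → π ∈G L → ∃[ i ] (π ≈ₚ lookup L i)
  index π∈L = Any.index π∈L , lookup-index π∈L

  select : (L : List (Perm n)) {R : Pred (Fin (length L)) 0ℓ} → Decidable R → List (Perm n)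
  select L R? = map (lookup L) (filter R? (allFin (length L)))

  module _ (L : List (Perm n)) {R : Pred (Fin (length L)) 0ℓ} (R? : Decidable R) where

    length-select : length (select L R?) ≡ count R?
    length-select = trans (length-map (lookup L) (filter R? (allFin (length L)))) (length-filter-tabulate R? (λ i → i))

    select-distinct : Distinct L → Distinct (select L R?)
    select-distinct L! = Uniqueₛ.map⁺ (setoid _) ≈ₚ-setoid (Distinct⇒lookup-injective L!)
      (Unique.filter⁺ R? {allFin (length L)} (Unique.allFin⁺ (length L)))

    ∈-select⁻ : ∀ {π} → π ∈ₗ select L R? → ∃[ i ] (R i × π ≡ lookup L i)
    ∈-select⁻ π∈ with i , i∈ , refl ← ∈-map⁻ (lookup L) π∈ = i , proj₂ (∈-filter⁻ R? {xs = allFin (length L)} i∈) , refl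

    select-⊆ : ∀ {π} → π ∈ₗ select L R? → π ∈G L
    select-⊆ π∈ with i , _ , refl ← ∈-select⁻ π∈ = Any.map (λ { refl _ → refl }) (∈-lookup {xs = L} i)

-- The derangement graph of a permutation group

module DerangementGraph {n} {Ω : Subset n} {L : List (Perm n)} (G : IsPermGroupOn Ω L) where

  open IsPermGroupOn G

  private
    p : ℕ
    p = length L

    a : Fin p → Perm n
    a = lookup L

  Deranged : Rel (Fin p) 0ℓ
  Deranged i j = ¬ Intersect Ω (a i) (a j)

  deranged? : ∀ i j → Dec (Deranged i j)
  deranged? i j = ¬? (intersect? Ω (a i) (a j))

  deranged-sym : Symmetric Deranged
  deranged-sym {i} {j} ¬ij ji = ¬ij (intersect-sym {π = a j} {a i} ji)

  ¬deranged⇒intersect : ∀ {i j} → ¬ Deranged i j → Intersect Ω (a i) (a j)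
  ¬deranged⇒intersect {i} {j} = decidable-stable (intersect? Ω (a i) (a j))

  module _ {x₀ : Fin n} where

    -- the coset of the stabiliser of x₀ containing c: the elements that send x₀ where c does
    Coset : Fin p → Pred (Fin p) 0ℓ
    Coset c i = a i ⟨$⟩ʳ x₀ ≡ a c ⟨$⟩ʳ x₀

    coset? : ∀ c → Decidable (Coset c)
    coset? c i = a i ⟨$⟩ʳ x₀ ≟ a c ⟨$⟩ʳ x₀

    stabilizer≤coset : ∀ i → length (stabilizer L x₀) ≤ count (λ c → coset? c i)
    stabilizer≤coset i = begin
      length (stabilizer L x₀)                     ≡⟨ length-filter≡count (λ g → g ⟨$⟩ʳ x₀ ≟ x₀) L ⟩
      count stab?                                  ≡⟨ length-filter-tabulate stab? (λ j → j) ⟨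
      length (filter stab? (allFin p))             ≡⟨ length-map shift (filter stab? (allFin p)) ⟨
      length (map shift (filter stab? (allFin p))) ≤⟨ pigeonhole (λ c → coset? c i) shifted-unique shifted-in-coset ⟩
      count (λ c → coset? c i)                     ∎
      where
      open ≤-Reasoning
      stab? : Decidable (λ j → a j ⟨$⟩ʳ x₀ ≡ x₀)
      stab? j = a j ⟨$⟩ʳ x₀ ≟ x₀
      shift-index : ∀ j → ∃[ k ] ((a j ∘ₚ a i) ≈ₚ a k)
      shift-index j = index {π = a j ∘ₚ a i} {L} (closed-∘ (∈-lookup {xs = L} j) (∈-lookup {xs = L} i))
      shift : Fin p → Fin p
      shift j = proj₁ (shift-index j)
      shift-injective : ∀ {j k} → shift j ≡ shift k → j ≡ k
      shift-injective {j} {k} eq = Distinct⇒lookup-injective distinct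
        (∘ₚ-cancelʳ (a j) (a k) (a i) λ x → trans (proj₂ (shift-index j) x)
          (trans (cong (λ l → a l ⟨$⟩ʳ x) eq) (sym (proj₂ (shift-index k) x))))
      shifted-unique : Unique (map shift (filter stab? (allFin p)))
      shifted-unique = Unique.map⁺ shift-injective (Unique.filter⁺ stab? {allFin p} (Unique.allFin⁺ p))
      shifted-in-coset : All (λ c → Coset c i) (map shift (filter stab? (allFin p)))
      shifted-in-coset = All.map⁺ (All.map (λ {j} fixed → trans (cong (a i ⟨$⟩ʳ_) (sym fixed)) (proj₂ (shift-index j) x₀))
                                           (All.all-filter stab? (allFin p)))

    module _ (ekr : EKR Ω L) (x₀∈Ω : x₀ ∈ Ω)
             (x₀-max : ∀ {y} → y ∈ Ω → length (stabilizer L y) ≤ length (stabilizer L x₀))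
             {S : Pred (Fin p) 0ℓ} (S? : Decidable S) (S-indep : Independent Deranged S) where

      private
        s : ℕ
        s = length (stabilizer L x₀)

        N? : Decidable (ClosedNbhd Deranged S)
        N? = closedNbhd? deranged? S?

        K? : ∀ c → Decidable (Coset c ∩ ∁ (ClosedNbhd Deranged S))
        K? c = coset? c ∩? ∁? N?

        family? : ∀ c → Decidable (λ i → (Coset c ∩ ∁ (ClosedNbhd Deranged S)) i ⊎ S i)
        family? c = K? c ∪? S?

        family-intersecting : ∀ c → Intersecting Ω (select L (family? c))
        family-intersecting c π∈ σ∈ with ∈-select⁻ L (family? c) π∈ | ∈-select⁻ L (family? c) σ∈
        ... | i , inj₁ (ci , _) , refl | j , inj₁ (cj , _) , refl = agree⇒intersect {π = a i} {a j} x₀∈Ω (trans ci (sym cj))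
        ... | i , inj₂ Si , refl | j , inj₂ Sj , refl = ¬deranged⇒intersect (S-indep Si Sj)
        ... | i , inj₁ (_ , i∉N) , refl | j , inj₂ Sj , refl = ¬deranged⇒intersect λ ij → i∉N (inj₂ (j , Sj , ij))
        ... | i , inj₂ Si , refl | j , inj₁ (_ , j∉N) , refl = ¬deranged⇒intersect λ ij → j∉N (inj₂ (i , Si , deranged-sym ij))

        family-bound : ∀ c → count (K? c) + count S? ≤ s
        family-bound c with ekr (select L (family? c)) (select-distinct L (family? c) distinct)
                                (select-⊆ L (family? c)) (family-intersecting c)
        ... | y , y∈Ω , |family|≤ = begin
          count (K? c) + count S?         ≤⟨ count-disjoint (K? c) S? (family? c) inj₁ inj₂ (λ _ (_ , i∉N) Si → i∉N (inj₁ Si)) ⟩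
          count (family? c)              ≡⟨ length-select L (family? c) ⟨
          length (select L (family? c)) ≤⟨ ≤-trans |family|≤ (x₀-max y∈Ω) ⟩
          s                              ∎
          where open ≤-Reasoning

        coverage : s * count (∁? N?) ≤ ∑[ c < p ] count (K? c)
        coverage = begin
          s * count (∁? N?)                                   ≡⟨ *-distribˡ-sum s (ind ∘ ∁? N?) ⟩
          ∑[ i < p ] (s * ind (∁? N? i))                      ≤⟨ ∑-mono-≤ per-point ⟩
          ∑[ i < p ] ∑[ c < p ] ind (coset? c i ×-dec ∁? N? i) ≡⟨ ∑-comm (λ c i → ind (coset? c i ×-dec ∁? N? i)) ⟨
          ∑[ c < p ] count (K? c)                              ∎
          where
          open ≤-Reasoning
          per-point : ∀ i → s * ind (∁? N? i) ≤ count (λ c → coset? c i ×-dec ∁? N? i)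
          per-point i with ∁? N? i
          ... | yes i∉N = subst (_≤ count (λ c → coset? c i ×-dec yes i∉N)) (sym (*-identityʳ s))
            (≤-trans (stabilizer≤coset i) (count-mono (λ c → coset? c i) (λ c → coset? c i ×-dec yes i∉N) (_, i∉N)))
          ... | no i∈N  = subst (_≤ count (λ c → coset? c i ×-dec no i∈N)) (sym (*-zeroʳ s)) z≤n

      ekr⇒neighbourhoodBound : p * count S? ≤ s * count N?
      ekr⇒neighbourhoodBound = +-cancelʳ-≤ (s * count (∁? N?)) (p * count S?) (s * count N?) (begin
        p * count S? + s * count (∁? N?)              ≤⟨ +-monoʳ-≤ (p * count S?) coverage ⟩
        p * count S? + ∑[ c < p ] count (K? c)        ≡⟨ +-comm (p * count S?) _ ⟩
        ∑[ c < p ] count (K? c) + p * count S?        ≡⟨ cong (∑[ c < p ] count (K? c) +_) (∑-const p (count S?)) ⟨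
        ∑[ c < p ] count (K? c) + ∑[ c < p ] count S? ≡⟨ ∑-distrib-+ (count ∘ K?) (λ _ → count S?) ⟨
        ∑[ c < p ] (count (K? c) + count S?)          ≤⟨ ∑-mono-≤ family-bound ⟩
        ∑[ c < p ] s                                  ≡⟨ ∑-const p s ⟩
        p * s                                         ≡⟨ cong (_* s) (count-complement N?) ⟨
        (count N? + count (∁? N?)) * s                ≡⟨ *-distribʳ-+ s (count N?) _ ⟩
        count N? * s + count (∁? N?) * s              ≡⟨ cong₂ _+_ (*-comm (count N?) s) (*-comm (count (∁? N?)) s) ⟩
        s * count N? + s * count (∁? N?)              ∎)
        where open ≤-Reasoning

-- Internal direct products of two permutation groups with disjoint supports

module _ {n : ℕ} where

  -- prodList (suc k) Gs is Gs zero · prodList k (Gs ∘ suc) by definition.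
  infixl 7 _·_
  _·_ : List (Perm n) → List (Perm n) → List (Perm n)
  A · B = concatMap (λ g → map (λ h → g ∘ₚ h) B) A

  ∈-·⁻ : ∀ A B {π} → π ∈ₗ A · B → ∃[ g ] ∃[ h ] (g ∈ₗ A × h ∈ₗ B × π ≡ g ∘ₚ h)
  ∈-·⁻ A B π∈ with ∈-concat⁻′ (map (λ g → map (g ∘ₚ_) B) A) π∈
  ... | _ , π∈block , block∈ with ∈-map⁻ (λ g → map (g ∘ₚ_) B) block∈
  ... | g , g∈A , refl with ∈-map⁻ (g ∘ₚ_) π∈block
  ... | h , h∈B , refl = g , h , g∈A , h∈B , refl

  ∈-·⁺ : ∀ {A B : List (Perm n)} {g h : Perm n} → g ∈ₗ A → h ∈ₗ B → g ∘ₚ h ∈ₗ A · B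
  ∈-·⁺ {B = B} {g} g∈A h∈B = ∈-concat⁺′ (∈-map⁺ (g ∘ₚ_) h∈B) (∈-map⁺ (λ g → map (g ∘ₚ_) B) g∈A)

  ∈G-·⁺ : ∀ {A B : List (Perm n)} {g h : Perm n} → g ∈G A → h ∈G B → (g ∘ₚ h) ∈G (A · B)
  ∈G-·⁺ {g = g} {h} g∈A h∈B with g′ , g′∈A , g≈g′ ← find g∈A | h′ , h′∈B , h≈h′ ← find h∈B =
    Any.map (λ { refl → ∘ₚ-cong {π = g} {g′} {h} {h′} g≈g′ h≈h′ }) (∈-·⁺ g′∈A h′∈B)

  length-filter-· : ∀ {P : Pred (Perm n) _} (P? : Decidable P) A B →
    length (filter P? (A · B)) ≡ ∑[ i < length A ] count (λ j → P? (lookup A i ∘ₚ lookup B j))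
  length-filter-· P? []      B = refl
  length-filter-· P? (g ∷ A) B = begin
    length (filter P? (map (g ∘ₚ_) B ++ A · B))                      ≡⟨ cong length (filter-++ P? (map (g ∘ₚ_) B) (A · B)) ⟩
    length (filter P? (map (g ∘ₚ_) B) ++ filter P? (A · B))         ≡⟨ length-++ (filter P? (map (g ∘ₚ_) B)) ⟩
    length (filter P? (map (g ∘ₚ_) B)) + length (filter P? (A · B)) ≡⟨ cong₂ _+_ block (length-filter-· P? A B) ⟩
    count (λ j → P? (g ∘ₚ lookup B j)) + ∑[ i < length A ] count (λ j → P? (lookup A i ∘ₚ lookup B j)) ∎
    where
    open ≡-Reasoning
    block : length (filter P? (map (g ∘ₚ_) B)) ≡ count (λ j → P? (g ∘ₚ lookup B j))
    block = trans (cong (λ B′ → length (filter P? (map (g ∘ₚ_) B′))) (sym (tabulate-lookup B)))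
                  (trans (cong (length ∘ filter P?) (map-tabulate (lookup B) (g ∘ₚ_)))
                         (length-filter-tabulate P? (λ j → g ∘ₚ lookup B j)))

module DisjointSupports {n} {Ω₁ Ω₂ : Subset n} (disjoint : ∀ {x} → x ∈ Ω₁ → x ∉ Ω₂) where

  private
    disjoint′ : ∀ {x} → x ∈ Ω₂ → x ∉ Ω₁
    disjoint′ x∈Ω₂ x∈Ω₁ = disjoint x∈Ω₁ x∈Ω₂

  module _ {g h : Perm n} (g-supp : Supported Ω₁ g) (h-supp : Supported Ω₂ h) where

    ∘ₚ-on-Ω₁ : ∀ {x} → x ∈ Ω₁ → (g ∘ₚ h) ⟨$⟩ʳ x ≡ g ⟨$⟩ʳ x
    ∘ₚ-on-Ω₁ x∈Ω₁ = fixes h-supp _ (disjoint (supported-∈ g-supp x∈Ω₁))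

    ∘ₚ-off-Ω₁ : ∀ {x} → x ∉ Ω₁ → (g ∘ₚ h) ⟨$⟩ʳ x ≡ h ⟨$⟩ʳ x
    ∘ₚ-off-Ω₁ x∉Ω₁ = cong (h ⟨$⟩ʳ_) (fixes g-supp _ x∉Ω₁)

    ∘ₚ-comm : (g ∘ₚ h) ≈ₚ (h ∘ₚ g)
    ∘ₚ-comm x with x ∈? Ω₁ | x ∈? Ω₂
    ... | yes x∈Ω₁ | _        = trans (∘ₚ-on-Ω₁ x∈Ω₁) (cong (g ⟨$⟩ʳ_) (sym (fixes h-supp x (disjoint x∈Ω₁))))
    ... | no x∉Ω₁  | yes x∈Ω₂ = trans (∘ₚ-off-Ω₁ x∉Ω₁) (sym (fixes g-supp _ (disjoint′ (supported-∈ h-supp x∈Ω₂))))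
    ... | no x∉Ω₁  | no x∉Ω₂  = trans (∘ₚ-off-Ω₁ x∉Ω₁) (trans (fixes h-supp x x∉Ω₂)
                                  (sym (trans (cong (g ⟨$⟩ʳ_) (fixes h-supp x x∉Ω₂)) (fixes g-supp x x∉Ω₁))))

  module _ {g h g′ h′ : Perm n} (g-supp : Supported Ω₁ g) (h-supp : Supported Ω₂ h)
           (g′-supp : Supported Ω₁ g′) (h′-supp : Supported Ω₂ h′) where

    ∘ₚ-injective : (g ∘ₚ h) ≈ₚ (g′ ∘ₚ h′) → g ≈ₚ g′ × h ≈ₚ h′
    ∘ₚ-injective eq = g≈g′ , h≈h′
      where
      g≈g′ : g ≈ₚ g′
      g≈g′ x with x ∈? Ω₁
      ... | yes x∈Ω₁ = trans (sym (∘ₚ-on-Ω₁ g-supp h-supp x∈Ω₁)) (trans (eq x) (∘ₚ-on-Ω₁ g′-supp h′-supp x∈Ω₁))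
      ... | no x∉Ω₁  = trans (fixes g-supp x x∉Ω₁) (sym (fixes g′-supp x x∉Ω₁))
      h≈h′ : h ≈ₚ h′
      h≈h′ x with x ∈? Ω₂
      ... | yes x∈Ω₂ = trans (sym (∘ₚ-off-Ω₁ g-supp h-supp (disjoint′ x∈Ω₂)))
                             (trans (eq x) (∘ₚ-off-Ω₁ g′-supp h′-supp (disjoint′ x∈Ω₂)))
      ... | no x∉Ω₂  = trans (fixes h-supp x x∉Ω₂) (sym (fixes h′-supp x x∉Ω₂))

    intersect-∘ₚ⁻ : Intersect (Ω₁ ∪ Ω₂) (g ∘ₚ h) (g′ ∘ₚ h′) → Intersect Ω₁ g g′ ⊎ Intersect Ω₂ h h′
    intersect-∘ₚ⁻ gh∩g′h′ with x , x∈Ω , agree ← intersect⇒agree {π = g ∘ₚ h} {g′ ∘ₚ h′} gh∩g′h′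
      with x∈p∪q⁻ Ω₁ Ω₂ x∈Ω
    ... | inj₁ x∈Ω₁ = inj₁ (agree⇒intersect {π = g} {g′} x∈Ω₁
          (trans (sym (∘ₚ-on-Ω₁ g-supp h-supp x∈Ω₁)) (trans agree (∘ₚ-on-Ω₁ g′-supp h′-supp x∈Ω₁))))
    ... | inj₂ x∈Ω₂ = inj₂ (agree⇒intersect {π = h} {h′} x∈Ω₂
          (trans (sym (∘ₚ-off-Ω₁ g-supp h-supp (disjoint′ x∈Ω₂)))
                 (trans agree (∘ₚ-off-Ω₁ g′-supp h′-supp (disjoint′ x∈Ω₂)))))

module _ {n} {Ω₁ Ω₂ : Subset n} (disjoint : ∀ {x} → x ∈ Ω₁ → x ∉ Ω₂)
         {A B : List (Perm n)} (GA : IsPermGroupOn Ω₁ A) (GB : IsPermGroupOn Ω₂ B) where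

  open DisjointSupports disjoint
  private
    module GA = IsPermGroupOn GA
    module GB = IsPermGroupOn GB

    supportedA : ∀ {g} → g ∈ₗ A → Supported Ω₁ g
    supportedA g∈A = mkSupported (GA.supported g∈A)

    supportedB : ∀ {h} → h ∈ₗ B → Supported Ω₂ h
    supportedB h∈B = mkSupported (GB.supported h∈B)

  ·-distinct : ∀ {A′} → All (Supported Ω₁) A′ → Distinct A′ → Distinct (A′ · B)
  ·-distinct {[]}     []                 []           = []
  ·-distinct {g ∷ A′} (g-supp ∷ A′-supp) (g∉A′ ∷ A′!) =
    Uniqueₛ.++⁺ ≈ₚ-setoid {map (g ∘ₚ_) B} {A′ · B}
      (Uniqueₛ.map⁺ ≈ₚ-setoid ≈ₚ-setoid (λ {h} {h′} → ∘ₚ-cancelˡ g h h′) GB.distinct)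
      (·-distinct {A′} A′-supp A′!) (λ {v} → blocks-disjoint {v})
    where
    blocks-disjoint : Disjoint (≈ₚ-setoid {n}) (map (g ∘ₚ_) B) (A′ · B)
    blocks-disjoint (π∈block , π∈rest) with find π∈block | find π∈rest
    ... | σ , σ∈block , π≈σ | τ , τ∈rest , π≈τ with ∈-map⁻ (g ∘ₚ_) σ∈block | ∈-·⁻ A′ B τ∈rest
    ... | h , h∈B , refl | g′ , h′ , g′∈A′ , h′∈B , refl = All.lookup g∉A′ g′∈A′ (proj₁
      (∘ₚ-injective g-supp (supportedB h∈B) (All.lookup A′-supp g′∈A′) (supportedB h′∈B) λ x → trans (sym (π≈σ x)) (π≈τ x)))

  ·-isPermGroupOn : IsPermGroupOn (Ω₁ ∪ Ω₂) (A · B)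
  ·-isPermGroupOn = record
    { distinct   = ·-distinct (All.tabulate supportedA) GA.distinct
    ; supported  = supported
    ; hasId      = ∈G-·⁺ {g = id} {id} GA.hasId GB.hasId
    ; closed-∘   = closed-∘
    ; closed-inv = closed-inv
    }
    where
    supported : ∀ {π} → π ∈ₗ A · B → ∀ x → x ∉ Ω₁ ∪ Ω₂ → π ⟨$⟩ʳ x ≡ x
    supported π∈ x x∉Ω with g , h , g∈A , h∈B , refl ← ∈-·⁻ A B π∈ =
      trans (cong (h ⟨$⟩ʳ_) (GA.supported g∈A x (x∉Ω ∘ p⊆p∪q Ω₂))) (GB.supported h∈B x (x∉Ω ∘ q⊆p∪q Ω₁ Ω₂))
    closed-∘ : ∀ {π σ} → π ∈ₗ A · B → σ ∈ₗ A · B → (π ∘ₚ σ) ∈G (A · B)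
    closed-∘ π∈ σ∈ with g , h , g∈A , h∈B , refl ← ∈-·⁻ A B π∈ | g′ , h′ , g′∈A , h′∈B , refl ← ∈-·⁻ A B σ∈ =
      ∈G-resp-≈ {π = (g ∘ₚ h) ∘ₚ (g′ ∘ₚ h′)} {(g ∘ₚ g′) ∘ₚ (h ∘ₚ h′)}
        (λ x → cong (h′ ⟨$⟩ʳ_) (sym (∘ₚ-comm (supportedA g′∈A) (supportedB h∈B) (g ⟨$⟩ʳ x))))
        (∈G-·⁺ {g = g ∘ₚ g′} {h ∘ₚ h′} (GA.closed-∘ g∈A g′∈A) (GB.closed-∘ h∈B h′∈B))
    closed-inv : ∀ {π} → π ∈ₗ A · B → flip π ∈G (A · B)
    closed-inv π∈ with g , h , g∈A , h∈B , refl ← ∈-·⁻ A B π∈ =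
      ∈G-resp-≈ {π = flip (g ∘ₚ h)} {flip g ∘ₚ flip h}
        (λ x → sym (∘ₚ-comm (supported-flip (supportedA g∈A)) (supported-flip (supportedB h∈B)) x))
        (∈G-·⁺ {g = flip g} {flip h} (GA.closed-inv g∈A) (GB.closed-inv h∈B))

  private
    p q : ℕ
    p = length A
    q = length B

    a : Fin p → Perm n
    a = lookup A

    b : Fin q → Perm n
    b = lookup B

    a-supported : ∀ i → Supported Ω₁ (a i)
    a-supported i = supportedA (∈-lookup {xs = A} i)

    b-supported : ∀ j → Supported Ω₂ (b j)
    b-supported j = supportedB (∈-lookup {xs = B} j)

    fixes? : (x : Fin n) → Decidable (λ (g : Perm n) → g ⟨$⟩ʳ x ≡ x)
    fixes? x g = g ⟨$⟩ʳ x ≟ x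

  length-stabilizer-·₁ : ∀ {x} → x ∈ Ω₁ → length (stabilizer (A · B) x) ≡ length (stabilizer A x) * q
  length-stabilizer-·₁ {x} x∈Ω₁ = begin
    length (stabilizer (A · B) x)                  ≡⟨ length-filter-· (fixes? x) A B ⟩
    ∑[ i < p ] count (λ j → fixes? x (a i ∘ₚ b j)) ≡⟨ sum-cong-≗ (λ i → trans (count-cong _ _ (same i)) (∑-const q _)) ⟩
    ∑[ i < p ] (q * ind (fixes? x (a i)))          ≡⟨ *-distribˡ-sum q (ind ∘ fixes? x ∘ a) ⟨
    q * count (fixes? x ∘ a)                       ≡⟨ cong (q *_) (length-filter≡count (fixes? x) A) ⟨
    q * length (stabilizer A x)                    ≡⟨ *-comm q _ ⟩
    length (stabilizer A x) * q                    ∎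
    where
    open ≡-Reasoning
    same : ∀ i → (λ j → (a i ∘ₚ b j) ⟨$⟩ʳ x ≡ x) ≐ (λ _ → a i ⟨$⟩ʳ x ≡ x)
    same i = (λ {j} → trans (sym (∘ₚ-on-Ω₁ (a-supported i) (b-supported j) x∈Ω₁)))
           , (λ {j} → trans (∘ₚ-on-Ω₁ (a-supported i) (b-supported j) x∈Ω₁))

  length-stabilizer-·₂ : ∀ {x} → x ∈ Ω₂ → length (stabilizer (A · B) x) ≡ p * length (stabilizer B x)
  length-stabilizer-·₂ {x} x∈Ω₂ = begin
    length (stabilizer (A · B) x)                  ≡⟨ length-filter-· (fixes? x) A B ⟩
    ∑[ i < p ] count (λ j → fixes? x (a i ∘ₚ b j)) ≡⟨ sum-cong-≗ (λ i → count-cong _ _ (same i)) ⟩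
    ∑[ i < p ] count (fixes? x ∘ b)                ≡⟨ ∑-const p _ ⟩
    p * count (fixes? x ∘ b)                       ≡⟨ cong (p *_) (length-filter≡count (fixes? x) B) ⟨
    p * length (stabilizer B x)                    ∎
    where
    open ≡-Reasoning
    x∉Ω₁ : x ∉ Ω₁
    x∉Ω₁ x∈Ω₁ = disjoint x∈Ω₁ x∈Ω₂
    same : ∀ i → (λ j → (a i ∘ₚ b j) ⟨$⟩ʳ x ≡ x) ≐ (λ j → b j ⟨$⟩ʳ x ≡ x)
    same i = (λ {j} → trans (sym (∘ₚ-off-Ω₁ (a-supported i) (b-supported j) x∉Ω₁)))
           , (λ {j} → trans (∘ₚ-off-Ω₁ (a-supported i) (b-supported j) x∉Ω₁))

  private
    module DA = DerangementGraph GA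
    module DB = DerangementGraph GB

    InFamily : List (Perm n) → Fin p → Fin q → Set
    InFamily F i j = (a i ∘ₚ b j) ∈G F

  decode : ∀ {π} → π ∈G (A · B) → ∃[ i ] ∃[ j ] (π ≈ₚ (a i ∘ₚ b j))
  decode {π} π∈ with σ , σ∈ , π≈σ ← find π∈ with ∈-·⁻ A B σ∈
  ... | g , h , g∈A , h∈B , refl =
    Any.index g∈A , Any.index h∈B , subst₂ (λ g h → π ≈ₚ (g ∘ₚ h)) (lookup-index g∈A) (lookup-index h∈B) π≈σ

  index-pairs : ∀ {F : List (Perm n)} → Distinct F → (∀ {π} → π ∈ₗ F → π ∈G (A · B)) →
                ∃[ xs ] (length xs ≡ length F × Unique xs × All (uncurry (InFamily F)) xs)
  index-pairs {[]}    []           F⊆ = [] , refl , [] , []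
  index-pairs {π ∷ F} (π∉F ∷ F!) F⊆
    with i , j , π≈ ← decode {π} (F⊆ (here refl)) | xs , |xs| , xs! , xs∈F ← index-pairs F! (F⊆ ∘ there) =
    (i , j) ∷ xs , cong suc |xs| , All.map new xs∈F ∷ xs! , here (λ x → sym (π≈ x)) ∷ All.map there xs∈F
    where
    new : ∀ {k} → uncurry (InFamily F) k → (i , j) ≢ k
    new ij∈F refl = All.All¬⇒¬Any π∉F (∈G-resp-≈ {π = π} {a i ∘ₚ b j} π≈ ij∈F)

  EKR-· : Nonempty Ω₁ → Nonempty Ω₂ → EKR Ω₁ A → EKR Ω₂ B → EKR (Ω₁ ∪ Ω₂) (A · B)
  EKR-· Ω₁-nonempty Ω₂-nonempty ekrA ekrB F F! F⊆ F-intersecting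
    with xA , xA∈Ω₁ , xA-max ← maximiser Ω₁-nonempty (length ∘ stabilizer A)
       | xB , xB∈Ω₂ , xB-max ← maximiser Ω₂-nonempty (length ∘ stabilizer B)
       | xs , |xs|≡|F| , xs! , xs∈F ← index-pairs F! F⊆ = witness (⊔-sel (sA * q) (sB * p))
    where
    sA sB : ℕ
    sA = length (stabilizer A xA)
    sB = length (stabilizer B xB)

    0<sA : 0 < sA
    0<sA = filter-some (fixes? xA) (Any.map (λ id≈g → sym (id≈g xA)) GA.hasId)

    0<sB : 0 < sB
    0<sB = filter-some (fixes? xB) (Any.map (λ id≈h → sym (id≈h xB)) GB.hasId)

    in-family? : ∀ i j → Dec (InFamily F i j)
    in-family? i j = Any.any? (≈ₚ-dec (a i ∘ₚ b j)) F

    family-independent : TensorIndependent DA.Deranged DB.Deranged (InFamily F)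
    family-independent {i} {j} {i′} {j′} ij∈F i′j′∈F A-deranged B-deranged
      with π , π∈F , ij≈π ← find ij∈F | σ , σ∈F , i′j′≈σ ← find i′j′∈F
      with intersect-∘ₚ⁻ (a-supported i) (b-supported j) (a-supported i′) (b-supported j′)
             (intersect-resp-≈ {π = π} {a i ∘ₚ b j} {σ} {a i′ ∘ₚ b j′} (λ x → sym (ij≈π x)) (λ x → sym (i′j′≈σ x))
               (F-intersecting π∈F σ∈F))
    ... | inj₁ A-intersect = A-deranged A-intersect
    ... | inj₂ B-intersect = B-deranged B-intersect

    |F|≤ : length F ≤ sA * q ⊔ sB * p
    |F|≤ = begin
      length F        ≡⟨ |xs|≡|F| ⟨
      length xs       ≤⟨ pigeonhole₂ in-family? xs! xs∈F ⟩
      count₂ in-family? ≤⟨ tensor-independent-bound DA.deranged? DB.deranged? DA.deranged-sym DB.deranged-sym {sA} {sB}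
                            (DA.ekr⇒neighbourhoodBound {xA} ekrA xA∈Ω₁ xA-max) (DB.ekr⇒neighbourhoodBound {xB} ekrB xB∈Ω₂ xB-max)
                            in-family? family-independent
                            (*-mono-< 0<sA (≤-trans 0<sB (length-filter (fixes? xB) B)))
                            (*-mono-< 0<sB (≤-trans 0<sA (length-filter (fixes? xA) A))) ⟩
      sA * q ⊔ sB * p ∎
      where open ≤-Reasoning

    witness : sA * q ⊔ sB * p ≡ sA * q ⊎ sA * q ⊔ sB * p ≡ sB * p →
              ∃[ x ] (x ∈ Ω₁ ∪ Ω₂ × length F ≤ length (stabilizer (A · B) x))
    witness (inj₁ ≡sAq) = xA , p⊆p∪q Ω₂ xA∈Ω₁ ,
      subst (length F ≤_) (trans ≡sAq (sym (length-stabilizer-·₁ xA∈Ω₁))) |F|≤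
    witness (inj₂ ≡sBp) = xB , q⊆p∪q Ω₁ Ω₂ xB∈Ω₂ ,
      subst (length F ≤_) (trans ≡sBp (trans (*-comm sB p) (sym (length-stabilizer-·₂ xB∈Ω₂)))) |F|≤

-- Products of finitely many groups

module _ {n : ℕ} where

  trivial-isPermGroupOn : IsPermGroupOn {n} ⊥ (id ∷ [])
  trivial-isPermGroupOn = record
    { distinct   = [] ∷ []
    ; supported  = λ { (here refl) x _ → refl }
    ; hasId      = here (λ _ → refl)
    ; closed-∘   = λ { (here refl) (here refl) → here (λ _ → refl) }
    ; closed-inv = λ { (here refl) → here (λ _ → refl) }
    }

  -- The EKR property fails on the empty set (no point can witness it), so the induction over
  -- the factors starts at one factor, and there the trivial group on ⊥ is adjoined by hand.
  EKR-·-trivial : ∀ {Ω : Subset n} {A} → IsPermGroupOn Ω A → EKR Ω A → EKR (Ω ∪ ⊥) (A · (id ∷ []))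
  EKR-·-trivial {Ω} {A} GA ekr F F! F⊆ F-intersecting with ekr F F! F⊆A F-intersecting′
    where
    F⊆A : ∀ {π} → π ∈ₗ F → π ∈G A
    F⊆A π∈F with σ , σ∈ , π≈σ ← find (F⊆ π∈F) with ∈-·⁻ A (id ∷ []) σ∈
    ... | g , _ , g∈A , here refl , refl = Any.map (λ { refl → π≈σ }) g∈A
    F-intersecting′ : Intersecting Ω F
    F-intersecting′ π∈F σ∈F with x , x∈ , fixed ← F-intersecting π∈F σ∈F with x∈p∪q⁻ Ω ⊥ x∈
    ... | inj₁ x∈Ω = x , x∈Ω , fixed
    ... | inj₂ x∈⊥ = ⊥-elim (∉⊥ x∈⊥)
  ... | x , x∈Ω , |F|≤ = x , p⊆p∪q ⊥ x∈Ω ,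
    subst (length F ≤_) (sym (trans (length-stabilizer-·₁ (λ _ → ∉⊥) GA trivial-isPermGroupOn x∈Ω) (*-identityʳ _)))
      |F|≤

  PairwiseDisjoint : ∀ {k} → (Fin k → Subset n) → Set
  PairwiseDisjoint Ωs = ∀ i j x → x ∈ Ωs i → x ∈ Ωs j → i ≡ j

  ∈-bigUnion⁻ : ∀ k (Ωs : Fin k → Subset n) {x} → x ∈ bigUnion k Ωs → ∃[ i ] (x ∈ Ωs i)
  ∈-bigUnion⁻ zero    Ωs x∈ = ⊥-elim (∉⊥ x∈)
  ∈-bigUnion⁻ (suc k) Ωs x∈ with x∈p∪q⁻ (Ωs zero) (bigUnion k (Ωs ∘ suc)) x∈
  ... | inj₁ x∈Ω₀ = zero , x∈Ω₀
  ... | inj₂ x∈rest with i , x∈Ωᵢ ← ∈-bigUnion⁻ k (Ωs ∘ suc) x∈rest = suc i , x∈Ωᵢ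

  bigUnion-nonempty : ∀ {k} {Ωs : Fin (suc k) → Subset n} → Nonempty (Ωs zero) → Nonempty (bigUnion (suc k) Ωs)
  bigUnion-nonempty {k} {Ωs} (x , x∈Ω₀) = x , p⊆p∪q (bigUnion k (Ωs ∘ suc)) x∈Ω₀

  module _ {k} {Ωs : Fin (suc k) → Subset n} (disjoint : PairwiseDisjoint Ωs) where

    head-disjoint : ∀ {x} → x ∈ Ωs zero → x ∉ bigUnion k (Ωs ∘ suc)
    head-disjoint {x} x∈Ω₀ x∈rest with i , x∈Ωᵢ ← ∈-bigUnion⁻ k (Ωs ∘ suc) x∈rest
      with () ← disjoint zero (suc i) x x∈Ω₀ x∈Ωᵢ

    tail-disjoint : PairwiseDisjoint (Ωs ∘ suc)
    tail-disjoint i j x x∈Ωᵢ x∈Ωⱼ = fsuc-injective (disjoint (suc i) (suc j) x x∈Ωᵢ x∈Ωⱼ)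

  prodList-isPermGroupOn : ∀ k {Ωs : Fin k → Subset n} {Gs} → PairwiseDisjoint Ωs →
                           (∀ i → IsPermGroupOn (Ωs i) (Gs i)) → IsPermGroupOn (bigUnion k Ωs) (prodList k Gs)
  prodList-isPermGroupOn zero    disjoint groups = trivial-isPermGroupOn
  prodList-isPermGroupOn (suc k) disjoint groups = ·-isPermGroupOn (head-disjoint disjoint) (groups zero)
    (prodList-isPermGroupOn k (tail-disjoint disjoint) (groups ∘ suc))

  prodList-EKR : ∀ k {Ωs : Fin (suc k) → Subset n} {Gs} → PairwiseDisjoint Ωs → (∀ i → Nonempty (Ωs i)) →
                 (∀ i → IsPermGroupOn (Ωs i) (Gs i)) → (∀ i → EKR (Ωs i) (Gs i)) →
                 EKR (bigUnion (suc k) Ωs) (prodList (suc k) Gs)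
  prodList-EKR zero    disjoint nonempty groups ekr = EKR-·-trivial (groups zero) (ekr zero)
  prodList-EKR (suc k) {Ωs} disjoint nonempty groups ekr =
    EKR-· (head-disjoint disjoint) (groups zero) (prodList-isPermGroupOn (suc k) (tail-disjoint disjoint) (groups ∘ suc))
      (nonempty zero) (bigUnion-nonempty {Ωs = Ωs ∘ suc} (nonempty (suc zero))) (ekr zero)
      (prodList-EKR k (tail-disjoint disjoint) (nonempty ∘ suc) (groups ∘ suc) (ekr ∘ suc))

theorem5p16 : ∀ {n : ℕ} (k : ℕ) (Ωs : Fin k → Subset n) (Gs : Fin k → List (Perm n)) →
    1 ≤ k →
    (∀ i j x → x ∈ Ωs i → x ∈ Ωs j → i ≡ j) →
    (∀ i → Nonempty (Ωs i)) →
    (∀ i → IsPermGroupOn (Ωs i) (Gs i)) →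
    (∀ i → EKR (Ωs i) (Gs i)) →
    EKR (bigUnion k Ωs) (prodList k Gs)
theorem5p16 (suc k) Ωs Gs (s≤s z≤n) disjoint nonempty groups ekr = prodList-EKR k disjoint nonempty groups ekr
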